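{- Let $G=(V,E)$ be a finite simple graph, let $t\ge 2$ be an integer and let $w\in V^{t-1}$. Let $V_w=\{wx:\; x\in V\}\subseteq V^t$ and let $\langle V_w\rangle$ be the subgraph of $S(G,t)$ induced by $V_w$. If $u\in V_w$ and $v\in V^t\setminus V_w$ are adjacent in $S(G,t)$, then either $u$ is the extreme vertex of $\langle V_w\rangle$ or $u$ is adjacent to the extreme vertex of $\langle V_w\rangle$.
   Context: For a graph $G=(V,E)$ and a positive integer $t$, $V^t$ denotes the set of words $u=u_1u_2\cdots u_t$ of length $t$ over the alphabet $V$; concatenation of words $u,v$ is written $uv$. The generalized Sierpiński graph $S(G,t)$ has vertex set $V^t$, and $\{u,v\}$ is an edge if and only if there is $i\in\{1,\dots,t\}$ such that: (i) $u_j=v_j$ for all $j<i$; (ii) $u_i\ne v_i$ and $\{u_i,v_i\}\in E$; (iii) $u_j=v_i$ and $v_j=u_i$ for all $j>i$. The subgraph $\langle V_w\rangle$ is isomorphic to $G$, and there is exactly one vertex of $V_w$ of the form $w'xx\cdots x$ with $w'\in V^r$ for some $r\le t-2$ (i.e. the word ends with at least two equal letters $x$, equivalently the vertex $wx$ where $x$ is the last letter of $w$); this vertex is called the extreme vertex of $\langle V_w\rangle$. -}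

module Defs where

open import Data.Nat using (ℕ; suc)
open import Data.Fin using (Fin; _<_)
open import Data.Vec using (Vec; lookup; _∷ʳ_; last)
open import Data.Product using (Σ; _×_)
open import Relation.Nullary using (¬_)
open import Relation.Binary.PropositionalEquality using (_≡_)

record SimpleGraph (n : ℕ) : Set₁ where
  field
    Adj   : Fin n → Fin n → Set
    sym   : ∀ {x y} → Adj x y → Adj y x
    irrfl : ∀ {x} → ¬ Adj x x

open SimpleGraph public

-- Words of length t over the alphabet V = Fin n; letter positions are
-- indexed by Fin t (position 1 of the paper is index zero).
Word : ℕ → ℕ → Set
Word n t = Vec (Fin n) t

SAdj : ∀ {n t} → SimpleGraph n → Word n t → Word n t → Set
SAdj {n} {t} G u v =
  Σ (Fin t) λ i →
      (∀ (j : Fin t) → j < i → lookup u j ≡ lookup v j)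
    × (¬ (lookup u i ≡ lookup v i) × Adj G (lookup u i) (lookup v i))
    × (∀ (j : Fin t) → i < j → (lookup u j ≡ lookup v i) × (lookup v j ≡ lookup u i))

InVw : ∀ {n m} → Word n m → Word n (suc m) → Set
InVw {n} w u = Σ (Fin n) λ x → u ≡ w ∷ʳ x

extreme : ∀ {n m} → Word n (suc m) → Word n (suc (suc m))
extreme w = w ∷ʳ last w

module Submission where

-- Let u = wx ∈ V_w and let v ∉ V_w be adjacent to u in S(G,t) at position i.
--
-- * If i is the final position, condition (i) says v agrees with u, hence
--   with w, everywhere before it, so v ∈ V_w: impossible.
-- * Otherwise condition (iii) makes every letter of u after i equal to v_i.
--   If i precedes the last letter of w, both that letter and x are such
--   letters, so x = last w and u is the extreme vertex.  If i is the last
--   letter of w, then x = v_i and {last w, x} ∈ E.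
-- * Finally, two words w x and w y differing only in a final pair of adjacent
--   letters are adjacent in S(G,t) (at the last position), so in the latter
--   case u = w x is adjacent to the extreme vertex w (last w).

open import Defs hiding (sym)
open import Data.Nat using (ℕ; suc)
import Data.Nat.Base as ℕ
import Data.Nat.Properties as ℕₚ
open import Data.Fin using (Fin; zero; suc; fromℕ; inject₁; toℕ; _<_)
open import Data.Fin.Properties using (toℕ-inject₁; toℕ-fromℕ; inject₁ℕ<; ≤fromℕ)
open import Data.Fin.Relation.Unary.Top using (view; ‵fromℕ; ‵inj₁)
open import Data.Vec using (Vec; []; _∷_; lookup; _∷ʳ_; last)
open import Data.Product using (_,_; proj₁)
open import Data.Sum using (_⊎_; inj₁; inj₂)
open import Data.Empty using (⊥-elim)
open import Relation.Nullary using (¬_; yes; no)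
open import Relation.Binary.PropositionalEquality
  using (_≡_; _≢_; refl; sym; trans; cong; cong₂; subst; subst₂; module ≡-Reasoning)

private
  variable
    A : Set
    k n : ℕ

lookup-∷ʳ-inject₁ : (xs : Vec A k) (x : A) (j : Fin k) →
                    lookup (xs ∷ʳ x) (inject₁ j) ≡ lookup xs j
lookup-∷ʳ-inject₁ (a ∷ xs) x zero    = refl
lookup-∷ʳ-inject₁ (a ∷ xs) x (suc j) = lookup-∷ʳ-inject₁ xs x j

lookup-∷ʳ-fromℕ : (xs : Vec A k) (x : A) → lookup (xs ∷ʳ x) (fromℕ k) ≡ x
lookup-∷ʳ-fromℕ []       x = refl
lookup-∷ʳ-fromℕ (a ∷ xs) x = lookup-∷ʳ-fromℕ xs x

last≡lookup-fromℕ : (xs : Vec A (suc k)) → last xs ≡ lookup xs (fromℕ k)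
last≡lookup-fromℕ (a ∷ [])     = refl
last≡lookup-fromℕ (a ∷ b ∷ xs) = last≡lookup-fromℕ (b ∷ xs)

∷ʳ-η : (xs : Vec A k) (ys : Vec A (suc k)) →
       (∀ j → lookup ys (inject₁ j) ≡ lookup xs j) →
       ys ≡ xs ∷ʳ lookup ys (fromℕ k)
∷ʳ-η []       (b ∷ []) _    = refl
∷ʳ-η (a ∷ xs) (b ∷ ys) same =
  cong₂ _∷_ (same zero) (∷ʳ-η xs ys (λ j → same (suc j)))

inject₁<fromℕ : (j : Fin k) → inject₁ j < fromℕ k
inject₁<fromℕ {k} j = subst (λ b → toℕ (inject₁ j) ℕ.< b) (sym (toℕ-fromℕ k)) (inject₁ℕ< j)

fromℕ≮ : (j : Fin (suc k)) → ¬ (fromℕ k < j)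
fromℕ≮ j = ℕₚ.≤⇒≯ (≤fromℕ j)

inject₁-mono-< : {i j : Fin k} → i < j → inject₁ i < inject₁ j
inject₁-mono-< {i = i} {j} = subst₂ ℕ._<_ (sym (toℕ-inject₁ i)) (sym (toℕ-inject₁ j))

Adj⇒≢ : (G : SimpleGraph n) {x y : Fin n} → Adj G x y → x ≢ y
Adj⇒≢ G a refl = irrfl G a

SAdj-within-copy : (G : SimpleGraph n) (w : Word n k) {x y : Fin n} →
                   Adj G x y → SAdj G (w ∷ʳ x) (w ∷ʳ y)
SAdj-within-copy {k = k} G w {x} {y} x~y =
  fromℕ k , agree , (letters≢ , letters~) , λ j p → ⊥-elim (fromℕ≮ j p)
  where
  agree : ∀ j → j < fromℕ k → lookup (w ∷ʳ x) j ≡ lookup (w ∷ʳ y) j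
  agree j j<top with view j
  ... | ‵fromℕ  = ⊥-elim (ℕₚ.<-irrefl refl j<top)
  ... | ‵inj₁ {i = j′} _ =
    trans (lookup-∷ʳ-inject₁ w x j′) (sym (lookup-∷ʳ-inject₁ w y j′))
  letters≢ : lookup (w ∷ʳ x) (fromℕ k) ≢ lookup (w ∷ʳ y) (fromℕ k)
  letters≢ rewrite lookup-∷ʳ-fromℕ w x | lookup-∷ʳ-fromℕ w y = Adj⇒≢ G x~y
  letters~ : Adj G (lookup (w ∷ʳ x) (fromℕ k)) (lookup (w ∷ʳ y) (fromℕ k))
  letters~ rewrite lookup-∷ʳ-fromℕ w x | lookup-∷ʳ-fromℕ w y = x~y

agree-before-last⇒InVw : (w : Word n k) (x : Fin n) (v : Word n (suc k)) →
                         (∀ j → j < fromℕ k → lookup (w ∷ʳ x) j ≡ lookup v j) →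
                         InVw w v
agree-before-last⇒InVw {k = k} w x v agree =
  lookup v (fromℕ k) , ∷ʳ-η w v agree-w
  where
  agree-w : ∀ j → lookup v (inject₁ j) ≡ lookup w j
  agree-w j = trans (sym (agree (inject₁ j) (inject₁<fromℕ j))) (lookup-∷ʳ-inject₁ w x j)

interior-edge : (G : SimpleGraph n) (w : Word n (suc k)) (x : Fin n) (c : Fin n)
                (i : Fin (suc k)) →
                Adj G (lookup (w ∷ʳ x) (inject₁ i)) c →
                (∀ j → inject₁ i < j → lookup (w ∷ʳ x) j ≡ c) →
                x ≡ last w ⊎ Adj G x (last w)
interior-edge {k = k} G w x c i u~c later with view i
... | ‵fromℕ = inj₂ (SimpleGraph.sym G (subst₂ (Adj G) uᵢ≡last c≡x u~c))
  where
  open ≡-Reasoning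
  uᵢ≡last : lookup (w ∷ʳ x) (inject₁ (fromℕ k)) ≡ last w
  uᵢ≡last = trans (lookup-∷ʳ-inject₁ w x (fromℕ k)) (sym (last≡lookup-fromℕ w))
  c≡x : c ≡ x
  c≡x = begin
    c                               ≡⟨ sym (later (fromℕ (suc k)) (inject₁<fromℕ (fromℕ k))) ⟩
    lookup (w ∷ʳ x) (fromℕ (suc k)) ≡⟨ lookup-∷ʳ-fromℕ w x ⟩
    x                               ∎
... | ‵inj₁ {i = i′} _ = inj₁ (begin
    x                                        ≡⟨ sym (lookup-∷ʳ-fromℕ w x) ⟩
    lookup (w ∷ʳ x) (fromℕ (suc k))          ≡⟨ later _ (inject₁<fromℕ (inject₁ i′)) ⟩
    c                                        ≡⟨ sym (later _ (inject₁-mono-< (inject₁<fromℕ i′))) ⟩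
    lookup (w ∷ʳ x) (inject₁ (fromℕ k))      ≡⟨ lookup-∷ʳ-inject₁ w x (fromℕ k) ⟩
    lookup w (fromℕ k)                       ≡⟨ sym (last≡lookup-fromℕ w) ⟩
    last w                                   ∎)
  where open ≡-Reasoning

mainTheorem1 : ∀ {n : ℕ} (G : SimpleGraph n) (m : ℕ) (w : Word n (suc m))
    (u v : Word n (suc (suc m))) →
    InVw w u → ¬ InVw w v → SAdj G u v →
    (u ≡ extreme w) ⊎ SAdj G u (extreme w)
mainTheorem1 G m w .(w ∷ʳ x) v (x , refl) v∉Vw (i , before , (_ , u~v) , after)
  with view i
... | ‵fromℕ = ⊥-elim (v∉Vw (agree-before-last⇒InVw w x v before))
... | ‵inj₁ {i = i′} _
  with interior-edge G w x (lookup v (inject₁ i′)) i′ u~v (λ j p → proj₁ (after j p))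
...   | inj₁ x≡last = inj₁ (cong (w ∷ʳ_) x≡last)
...   | inj₂ x~last = inj₂ (SAdj-within-copy G w x~last)
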